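{- $d_p(\{0,1,4,6\}) \ge \frac{1}{7}$.
   Context: For $S \subseteq \mathbb{Z}$ and $a \in \mathbb{Z}$, write $S + a = \{s + a : s \in S\}$. A set $A \subseteq \mathbb{Z}$ is $S$-packing if for all $a_1 \neq a_2$ in $A$, $S + a_1$ and $S + a_2$ are disjoint. The upper density of $A \subseteq \mathbb{Z}$ is $\overline{d}(A) = \limsup_{n\to\infty} \frac{|A \cap [-n,n]|}{2n+1}$. The packing density of $S$ is $d_p(S) = \sup\{\overline{d}(A) : A \text{ is } S\text{ -packing}\}$. -}

module Defs where

open import Data.Bool using (Bool; true; false; if_then_else_)
open import Data.Nat as ℕ using (ℕ; zero; suc)
open import Data.Integer as ℤ using (ℤ; +_)
open import Data.Rational as ℚ using (ℚ; _<_; _-_; 0ℚ)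
open import Data.List using (List; []; _∷_)
open import Data.List.Membership.Propositional using (_∈_)
open import Data.Product using (Σ; ∃; _×_; _,_)
open import Relation.Binary.PropositionalEquality using (_≡_)
open import Relation.Nullary using (¬_)

Subsetℤ : Set
Subsetℤ = ℤ → Bool

_∈_+ₛ_ : ℤ → List ℤ → ℤ → Set
x ∈ S +ₛ a = Σ ℤ λ s → s ∈ S × x ≡ s ℤ.+ a

IsPacking : List ℤ → Subsetℤ → Set
IsPacking S A = ∀ a₁ a₂ → A a₁ ≡ true → A a₂ ≡ true → ¬ (a₁ ≡ a₂) →
                ∀ x → ¬ ((x ∈ S +ₛ a₁) × (x ∈ S +ₛ a₂))

countFrom : Subsetℤ → ℤ → ℕ → ℕ
countFrom A m zero = zero
countFrom A m (suc len) = (if A m then 1 else 0) ℕ.+ countFrom A (m ℤ.+ ℤ.1ℤ) len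

countSym : Subsetℤ → ℕ → ℕ
countSym A n = countFrom A (ℤ.- (+ n)) (suc (2 ℕ.* n))

ratio : Subsetℤ → ℕ → ℚ
ratio A n = (+ countSym A n) ℚ./ suc (2 ℕ.* n)

-- upper density of A is ≥ c, i.e. limsup_n |A ∩ [-n,n]|/(2n+1) ≥ c:
-- for every ε > 0 the ratio exceeds c - ε for arbitrarily large n.
UpperDensityGE : Subsetℤ → ℚ → Set
UpperDensityGE A c = ∀ (ε : ℚ) → 0ℚ < ε → ∀ (N : ℕ) →
                     Σ ℕ λ n → (N ℕ.≤ n) × (c - ε < ratio A n)

-- packing density of S is ≥ c, i.e. sup { upper density of A : A S-packing } ≥ c:
-- for every ε > 0 some S-packing set has upper density ≥ c - ε.
PackingDensityGE : List ℤ → ℚ → Set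
PackingDensityGE S c = ∀ (ε : ℚ) → 0ℚ < ε →
                       Σ Subsetℤ λ A → IsPacking S A × UpperDensityGE A (c - ε)

-- The multiples of 7 form a {0,1,4,6}-packing set: the elements 0, 1, 4, 6 are pairwise
-- incongruent modulo 7, so two translates s₁ + 7a₁ = s₂ + 7a₂ force s₁ = s₂ and then a₁ = a₂.
-- Since 7ℤ is 7-periodic with one element per period, its window [-n, n] with n = 7N + 3
-- consists of 2N + 1 full periods and contains exactly 2N + 1 multiples of 7, so the ratio
-- is exactly 1/7 for arbitrarily large n.
module Submission where

open import Defs
open import Data.List using (List; []; _∷_)
open import Data.Integer using (+_)
open import Data.Rational using (_/_)

open import Data.Bool using (true; if_then_else_)
open import Data.Nat as ℕ using (ℕ; zero; suc)
import Data.Nat.Properties as ℕP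
import Data.Nat.Tactic.RingSolver as ℕSolver
open import Data.Integer as ℤ using (ℤ)
import Data.Integer.Properties as ℤP
open import Data.Integer.Divisibility.Signed using (_∣_; _∣?_; ∣m+n∣n⇒∣m; ∣m∣n⇒∣m+n; ∣m∣n⇒∣m-n; ∣-refl)
open import Data.Integer.Tactic.RingSolver using (solve-∀)
open import Data.Rational as ℚ using (0ℚ)
import Data.Rational.Properties as ℚP
open import Data.Rational.Unnormalised using (mkℚᵘ; *≡*)
open import Data.List.Relation.Unary.All using (All; all?; lookup)
open import Data.Product using (_,_)
open import Function.Bundles using (mk⇔)
open import Relation.Nullary using (does; proof; Reflects; invert; _→-dec_; Dec; from-yes)
open import Relation.Nullary.Decidable using (does-⇔)
open import Relation.Binary.PropositionalEquality
open import Algebra.Properties.AbelianGroup ℤP.+-0-abelianGroup using (∙-cancelˡ)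
open import Algebra.Properties.CommutativeSemigroup ℤP.+-commutativeSemigroup using (xy∙z≈xz∙y; x∙yz≈xz∙y)
open ≡-Reasoning

multiplesOf : ℕ → Subsetℤ
multiplesOf q a = does (+ q ∣? a)

multiplesOf⇒∣ : ∀ {q a} → multiplesOf q a ≡ true → + q ∣ a
multiplesOf⇒∣ {q} {a} eq = invert (subst (Reflects (+ q ∣ a)) eq (proof (+ q ∣? a)))

Periodic : ℕ → Subsetℤ → Set
Periodic q A = ∀ m → A (m ℤ.+ + q) ≡ A m

multiplesOf-periodic : ∀ q → Periodic q (multiplesOf q)
multiplesOf-periodic q m =
  does-⇔ (mk⇔ (λ q∣m+q → ∣m+n∣n⇒∣m q∣m+q ∣-refl) (λ q∣m → ∣m∣n⇒∣m+n q∣m ∣-refl))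
         (+ q ∣? m ℤ.+ + q) (+ q ∣? m)

ResiduesDistinct : ℕ → List ℤ → Set
ResiduesDistinct q S = All (λ s₁ → All (λ s₂ → + q ∣ s₁ ℤ.- s₂ → s₁ ≡ s₂) S) S

residuesDistinct? : ∀ q S → Dec (ResiduesDistinct q S)
residuesDistinct? q S =
  all? (λ s₁ → all? (λ s₂ → (+ q ∣? s₁ ℤ.- s₂) →-dec (s₁ ℤ.≟ s₂)) S) S

+-exchange-≡ : ∀ {s₁ a₁ s₂ a₂ : ℤ} → s₁ ℤ.+ a₁ ≡ s₂ ℤ.+ a₂ → s₁ ℤ.- s₂ ≡ a₂ ℤ.- a₁
+-exchange-≡ {s₁} {a₁} {s₂} {a₂} eq = begin
  s₁ ℤ.- s₂                                             ≡⟨ regroup s₁ a₁ s₂ a₂ ⟩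
  ((s₁ ℤ.+ a₁) ℤ.- (s₂ ℤ.+ a₂)) ℤ.+ (a₂ ℤ.- a₁)         ≡⟨ cong (ℤ._+ (a₂ ℤ.- a₁)) (ℤP.i≡j⇒i-j≡0 eq) ⟩
  ℤ.0ℤ ℤ.+ (a₂ ℤ.- a₁)                                  ≡⟨ ℤP.+-identityˡ _ ⟩
  a₂ ℤ.- a₁                                             ∎
  where
  regroup : ∀ s₁ a₁ s₂ a₂ → s₁ ℤ.- s₂ ≡ ((s₁ ℤ.+ a₁) ℤ.- (s₂ ℤ.+ a₂)) ℤ.+ (a₂ ℤ.- a₁)
  regroup = solve-∀

multiplesOf-packing : ∀ {q S} → ResiduesDistinct q S → IsPacking S (multiplesOf q)
multiplesOf-packing {q} distinct a₁ a₂ a₁∈A a₂∈A a₁≢a₂ x ((s₁ , s₁∈S , x≡s₁+a₁) , (s₂ , s₂∈S , x≡s₂+a₂))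
  = a₁≢a₂ (∙-cancelˡ s₂ a₁ a₂ (subst (λ s → s ℤ.+ a₁ ≡ s₂ ℤ.+ a₂) s₁≡s₂ s₁+a₁≡s₂+a₂))
  where
  s₁+a₁≡s₂+a₂ : s₁ ℤ.+ a₁ ≡ s₂ ℤ.+ a₂
  s₁+a₁≡s₂+a₂ = trans (sym x≡s₁+a₁) x≡s₂+a₂

  q∣s₁-s₂ : + q ∣ s₁ ℤ.- s₂
  q∣s₁-s₂ = subst (+ q ∣_) (sym (+-exchange-≡ {s₁} {a₁} {s₂} {a₂} s₁+a₁≡s₂+a₂))
                  (∣m∣n⇒∣m-n {m = a₂} {n = a₁} (multiplesOf⇒∣ a₂∈A) (multiplesOf⇒∣ a₁∈A))

  s₁≡s₂ : s₁ ≡ s₂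
  s₁≡s₂ = lookup (lookup distinct s₁∈S) s₂∈S q∣s₁-s₂

window-length : ∀ r N → suc (2 ℕ.* (r ℕ.+ N ℕ.* suc (2 ℕ.* r))) ≡ suc (2 ℕ.* N) ℕ.* suc (2 ℕ.* r)
window-length = ℕSolver.solve-∀

module _ (A : Subsetℤ) where

  countFrom-+ : ∀ a b m → countFrom A m (a ℕ.+ b) ≡ countFrom A m a ℕ.+ countFrom A (m ℤ.+ + a) b
  countFrom-+ zero b m rewrite ℤP.+-identityʳ m = refl
  countFrom-+ (suc a) b m rewrite countFrom-+ a b (m ℤ.+ ℤ.1ℤ) | ℤP.+-assoc m ℤ.1ℤ (+ a) =
    sym (ℕP.+-assoc (if A m then 1 else 0) (countFrom A (m ℤ.+ ℤ.1ℤ) a) _)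

  module _ {q} (periodic : Periodic q A) where

    countFrom-shift-period : ∀ len m → countFrom A (m ℤ.+ + q) len ≡ countFrom A m len
    countFrom-shift-period zero m = refl
    countFrom-shift-period (suc len) m
      rewrite periodic m | xy∙z≈xz∙y m (+ q) ℤ.1ℤ =
      cong ((if A m then 1 else 0) ℕ.+_) (countFrom-shift-period len (m ℤ.+ ℤ.1ℤ))

    countFrom-shift-periods : ∀ k len m → countFrom A (m ℤ.+ + (k ℕ.* q)) len ≡ countFrom A m len
    countFrom-shift-periods zero len m rewrite ℤP.+-identityʳ m = refl
    countFrom-shift-periods (suc k) len m = begin
      countFrom A (m ℤ.+ + (q ℕ.+ k ℕ.* q)) len       ≡⟨ cong (λ i → countFrom A i len) (regroup m (k ℕ.* q)) ⟩
      countFrom A ((m ℤ.+ + (k ℕ.* q)) ℤ.+ + q) len   ≡⟨ countFrom-shift-period len _ ⟩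
      countFrom A (m ℤ.+ + (k ℕ.* q)) len             ≡⟨ countFrom-shift-periods k len m ⟩
      countFrom A m len                               ∎
      where
      regroup : ∀ m n → m ℤ.+ + (q ℕ.+ n) ≡ (m ℤ.+ + n) ℤ.+ + q
      regroup m n rewrite ℤP.pos-+ q n = x∙yz≈xz∙y m (+ q) (+ n)

    countFrom-periods : ∀ k m → countFrom A m (k ℕ.* q) ≡ k ℕ.* countFrom A m q
    countFrom-periods zero m = refl
    countFrom-periods (suc k) m rewrite countFrom-+ q (k ℕ.* q) m | countFrom-periods k (m ℤ.+ + q)
      | countFrom-shift-period q m = refl

  -- For an odd period q = 2r + 1 the window [-n, n] with n = r + Nq is exactly 2N + 1 periods.
  module _ {r} (periodic : Periodic (suc (2 ℕ.* r)) A) where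

    private
      q = suc (2 ℕ.* r)

    window-start : ∀ N → ℤ.- (+ (r ℕ.+ N ℕ.* q)) ℤ.+ + (N ℕ.* q) ≡ ℤ.- + r
    window-start N rewrite ℤP.pos-+ r (N ℕ.* q) = cancel (+ r) (+ (N ℕ.* q))
      where
      cancel : ∀ i j → ℤ.- (i ℤ.+ j) ℤ.+ j ≡ ℤ.- i
      cancel = solve-∀

    countSym-periodic : ∀ N → countSym A (r ℕ.+ N ℕ.* q) ≡ suc (2 ℕ.* N) ℕ.* countFrom A (ℤ.- + r) q
    countSym-periodic N = begin
      countFrom A m (suc (2 ℕ.* (r ℕ.+ N ℕ.* q)))  ≡⟨ cong (countFrom A m) (window-length r N) ⟩
      countFrom A m (suc (2 ℕ.* N) ℕ.* q)          ≡⟨ countFrom-periods periodic (suc (2 ℕ.* N)) m ⟩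
      suc (2 ℕ.* N) ℕ.* countFrom A m q            ≡⟨ cong (suc (2 ℕ.* N) ℕ.*_) one-period ⟩
      suc (2 ℕ.* N) ℕ.* countFrom A (ℤ.- + r) q    ∎
      where
      m = ℤ.- (+ (r ℕ.+ N ℕ.* q))
      one-period : countFrom A m q ≡ countFrom A (ℤ.- + r) q
      one-period = begin
        countFrom A m q                        ≡⟨ countFrom-shift-periods periodic N q m ⟨
        countFrom A (m ℤ.+ + (N ℕ.* q)) q      ≡⟨ cong (λ i → countFrom A i q) (window-start N) ⟩
        countFrom A (ℤ.- + r) q                ∎

/-cancelˡ : ∀ k c q → (+ (suc k ℕ.* c)) / (suc k ℕ.* suc q) ≡ (+ c) / suc q
/-cancelˡ k c q = ℚP.fromℚᵘ-cong {mkℚᵘ (+ (suc k ℕ.* c)) (q ℕ.+ k ℕ.* suc q)} {mkℚᵘ (+ c) q}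
  (*≡* (begin
    + (suc k ℕ.* c) ℤ.* + suc q  ≡⟨ ℤP.pos-* (suc k ℕ.* c) (suc q) ⟨
    + (suc k ℕ.* c ℕ.* suc q)    ≡⟨ cong +_ (cross k c q) ⟩
    + (c ℕ.* (suc k ℕ.* suc q))  ≡⟨ ℤP.pos-* c (suc k ℕ.* suc q) ⟩
    + c ℤ.* + (suc k ℕ.* suc q)  ∎))
  where
  cross : ∀ k c q → suc k ℕ.* c ℕ.* suc q ≡ c ℕ.* (suc k ℕ.* suc q)
  cross = ℕSolver.solve-∀

ratio-periodic : ∀ {A r} → Periodic (suc (2 ℕ.* r)) A → ∀ N →
                 ratio A (r ℕ.+ N ℕ.* suc (2 ℕ.* r)) ≡ (+ countFrom A (ℤ.- + r) (suc (2 ℕ.* r))) / suc (2 ℕ.* r)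
ratio-periodic {A} {r} periodic N = begin
  ratio A n                                                    ≡⟨ ℚP./-cong (cong +_ (countSym-periodic A periodic N)) (window-length r N) ⟩
  (+ (suc (2 ℕ.* N) ℕ.* c)) / (suc (2 ℕ.* N) ℕ.* suc (2 ℕ.* r)) ≡⟨ /-cancelˡ (2 ℕ.* N) c (2 ℕ.* r) ⟩
  (+ c) / suc (2 ℕ.* r)                                        ∎
  where
  n = r ℕ.+ N ℕ.* suc (2 ℕ.* r)
  c = countFrom A (ℤ.- + r) (suc (2 ℕ.* r))

p-q<p : ∀ p {q} → 0ℚ ℚ.< q → p ℚ.- q ℚ.< p
p-q<p p 0<q = subst (p ℚ.- _ ℚ.<_) (ℚP.+-identityʳ p) (ℚP.+-mono-≤-< (ℚP.≤-refl {p}) (ℚP.neg-antimono-< 0<q))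

upperDensityGE-periodic : ∀ {A r d} → Periodic (suc (2 ℕ.* r)) A →
                          d ℚ.≤ (+ countFrom A (ℤ.- + r) (suc (2 ℕ.* r))) / suc (2 ℕ.* r) →
                          UpperDensityGE A d
upperDensityGE-periodic {A} {r} {d} periodic d≤c ε 0<ε N =
  r ℕ.+ N ℕ.* suc (2 ℕ.* r) ,
  ℕP.≤-trans (ℕP.m≤m*n N (suc (2 ℕ.* r))) (ℕP.m≤n+m _ r) ,
  subst (d ℚ.- ε ℚ.<_) (sym (ratio-periodic periodic N)) (ℚP.<-≤-trans (p-q<p d 0<ε) d≤c)

corollary3p6 : PackingDensityGE (+ 0 ∷ + 1 ∷ + 4 ∷ + 6 ∷ []) ((+ 1) / 7)
corollary3p6 ε 0<ε =
  multiplesOf 7 ,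
  multiplesOf-packing (from-yes (residuesDistinct? 7 (+ 0 ∷ + 1 ∷ + 4 ∷ + 6 ∷ []))) ,
  upperDensityGE-periodic {r = 3} (multiplesOf-periodic 7) (ℚP.<⇒≤ (p-q<p _ 0<ε))
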